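{- Let $r$ be a positive integer and let $a,b$ be vertices of the Kneser graph $K(2r+1,r)$ with $|a\cap b|=t\ge 1$. Let $C=a\cap b$, $A=a\setminus b=\{a_1,\dots,a_{r-t}\}$, $B=b\setminus a=\{b_1,\dots,b_{r-t}\}$ (with these orderings fixed) and $D=[2r+1]\setminus(a\cup b)$. For $i\in\{1,\dots,r-t\}$ let $$x_{2i-1}=A_{\le i-1}\cup B_{\ge r-t-i}\cup D,$$ and for $i\in\{0,1,\dots,r-t\}$ let $$x_{2i}=B_{\le i}\cup A_{\ge r-t-i}\cup C.$$ Then $a=x_0,x_1,\dots,x_{2(r-t)}=b$ is an induced $a,b$-path in $K(2r+1,r)$ of length $2(r-t)$.
   Context: The Kneser graph $K(2r+1,r)$ has as vertices all $r$-element subsets of $[2r+1]=\{1,\dots,2r+1\}$, two vertices being adjacent iff they are disjoint. For an ordered set $X=\{x_1,\dots,x_m\}$ and an integer $0\le k\le m$: $X_{\le k}=\{x_1,\dots,x_k\}$ and $X_{\ge k}=\{x_{m-k+1},\dots,x_m\}$ (the first $k$ and the last $k$ elements), with $X_{\le 0}=X_{\ge 0}=\emptyset$. A path is induced if no two non-consecutive vertices of it are adjacent. -}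

module Defs where

open import Data.Nat using (ℕ; zero; suc; _+_; _*_; _∸_; _<_; _≤_; _<?_; _≤?_; ⌊_/2⌋; ⌈_/2⌉)
open import Data.Bool using (Bool; true; false; if_then_else_)
open import Data.Fin using (Fin; toℕ)
open import Data.Fin.Subset using (Subset; ⋃; ⁅_⁆; _∩_; _∪_; ∣_∣; Empty)
open import Data.List using (List; map; filter; allFin)
open import Relation.Binary.PropositionalEquality using (_≡_)
open import Relation.Nullary using (¬_)

Ground : ℕ → Set
Ground r = Fin (suc (2 * r))

IsKneserVertex : (r : ℕ) → Subset (suc (2 * r)) → Set
IsKneserVertex r p = ∣ p ∣ ≡ r

KneserAdj : {n : ℕ} → Subset n → Subset n → Set
KneserAdj p q = Empty (p ∩ q)

-- X_{≤k} for an ordered set X = {α 0, …, α (m-1)} (0-based indices):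
-- the elements with index < k.
firstK : {n : ℕ} (m : ℕ) → (Fin m → Fin n) → ℕ → Subset n
firstK m α k = ⋃ (map (λ i → ⁅ α i ⁆) (filter (λ i → toℕ i <? k) (allFin m)))

-- X_{≥k}: the last k elements, i.e. those with (0-based) index ≥ m - k.
lastK : {n : ℕ} (m : ℕ) → (Fin m → Fin n) → ℕ → Subset n
lastK m α k = ⋃ (map (λ i → ⁅ α i ⁆) (filter (λ i → m ∸ k ≤? toℕ i) (allFin m)))

isEven : ℕ → Bool
isEven zero = true
isEven (suc n) with isEven n
... | true = false
... | false = true

IsInducedKneserPath : (r : ℕ) → (ℕ → Subset (suc (2 * r))) → ℕ → Set
IsInducedKneserPath r x ℓ =
  (∀ j → j ≤ ℓ → IsKneserVertex r (x j))
  × (∀ j k → j ≤ ℓ → k ≤ ℓ → x j ≡ x k → j ≡ k)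
  × (∀ j → j < ℓ → KneserAdj (x j) (x (suc j)))
  × (∀ j k → k ≤ ℓ → suc (suc j) ≤ k → ¬ KneserAdj (x j) (x k))
  where open import Data.Product using (_×_)

-- The sequence of the lemma, with m = r - t, A enumerated by α, B by β:
--   x_{2i}   = B_{≤ i} ∪ A_{≥ m-i} ∪ C
--   x_{2i-1} = A_{≤ i-1} ∪ B_{≥ m-i} ∪ D
pathSeq : {n : ℕ} (m : ℕ) (α β : Fin m → Fin n) (C D : Subset n) → ℕ → Subset n
pathSeq m α β C D j =
  if isEven j
  then (firstK m β ⌊ j /2⌋ ∪ lastK m α (m ∸ ⌊ j /2⌋)) ∪ C
  else (firstK m α (⌈ j /2⌉ ∸ 1) ∪ lastK m β (m ∸ ⌈ j /2⌉)) ∪ D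

-- Write x_{2k} = B_{<k} ∪ A_{≥k} ∪ C and x_{2k+1} = A_{<k} ∪ B_{>k} ∪ D
-- (0-based indices into the orderings of A and B).  Every element of [2r+1]
-- lies in exactly one of C, D, A, B, and tracking where it lies shows that each
-- vertex is the complement of its predecessor with one element removed:
-- x_{2k+1} = ∁ x_{2k} − b_k and x_{2k+2} = ∁ x_{2k+1} − a_k.  In K(2r+1, r)
-- such a set is again an r-set and is disjoint from its predecessor, which
-- gives the vertices and the edges.  Distinct vertices are told apart by a
-- single element (a_k, b_k or an element of C), and vertices at distance at
-- least two share an element of C, of D, or some a_k or b_k.

module Submission where

open import Data.Bool using (true; false; not)
open import Data.Fin using (Fin; toℕ; fromℕ<)
open import Data.Fin.Properties using (toℕ<n; toℕ-fromℕ<; toℕ-injective)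
open import Data.Fin.Subset
open import Data.Fin.Subset.Properties
open import Data.List using ([]; _∷_; map; filter; allFin)
open import Data.List.Membership.Propositional using () renaming (_∈_ to _∈ₗ_)
open import Data.List.Membership.Propositional.Properties
  using (∈-map∘filter⁺; ∈-map∘filter⁻; ∈-allFin)
import Data.List.Relation.Unary.Any as Any
open import Data.Nat
  using (ℕ; zero; suc; _+_; _*_; _∸_; _≤_; _<_; _<?_; z≤n; s≤s; s≤s⁻¹; s<s⁻¹)
open import Data.Nat.Properties
open import Data.Product using (_×_; ∃; _,_; proj₁; proj₂)
open import Data.Sum using (_⊎_; inj₁; inj₂; [_,_]′)
open import Data.Vec as Vec using (_∷_; here; there)
open import Defs
open import Function.Base using (_∘_)
open import Function.Bundles using (_⇔_; Equivalence)
open import Function.Definitions using (Injective)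
open import Level using (0ℓ)
open import Relation.Binary.Definitions using (tri<; tri≈; tri>)
open import Relation.Binary.PropositionalEquality
open import Relation.Nullary using (¬_; yes; no; contradiction)
open import Relation.Unary using (Pred; Decidable)

open Equivalence using (to; from)

isEven-suc : ∀ n → isEven (suc n) ≡ not (isEven n)
isEven-suc n with isEven n
... | true  = refl
... | false = refl

isEven-n+n : ∀ n → isEven (n + n) ≡ true
isEven-n+n zero    = refl
isEven-n+n (suc n) rewrite +-suc n n | isEven-suc (suc (n + n))
                         | isEven-suc (n + n) | isEven-n+n n = refl

data Parity : ℕ → Set where
  even : ∀ k → Parity (k + k)
  odd  : ∀ k → Parity (suc (k + k))

parity : ∀ n → Parity n
parity zero = even 0
parity (suc n) with parity n
... | even k = odd k
... | odd k  = subst Parity (cong suc (+-suc k k)) (even (suc k))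

k+k≤l+l⇒k≤l : ∀ {k l} → k + k ≤ l + l → k ≤ l
k+k≤l+l⇒k≤l {k} {l} h =
  subst₂ _≤_ (sym (n≡⌊n+n/2⌋ k)) (sym (n≡⌊n+n/2⌋ l)) (⌊n/2⌋-mono h)

k+k<l+l⇒k<l : ∀ {k l} → k + k < l + l → k < l
k+k<l+l⇒k<l {k} {l} h =
  subst₂ _≤_ (cong suc (sym (n≡⌊n+n/2⌋ k))) (sym (n≡⌈n+n/2⌉ l)) (⌈n/2⌉-mono h)

2*n≡n+n : ∀ n → 2 * n ≡ n + n
2*n≡n+n n = cong (n +_) (+-identityʳ n)

x∈p─q⇒x∉q : ∀ {n} (p q : Subset n) {x} → x ∈ p ─ q → x ∉ q
x∈p─q⇒x∉q (_ ∷ p) (inside ∷ q) ()         here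
x∈p─q⇒x∉q (_ ∷ p) (_      ∷ q) (there x∈) (there x∈q) = x∈p─q⇒x∉q p q x∈ x∈q

x∈∁p-y⁺ : ∀ {n} {p : Subset n} {x y} → x ∉ p → x ≢ y → x ∈ ∁ p - y
x∈∁p-y⁺ x∉p x≢y = x∈p∧x≢y⇒x∈p-y (x∉p⇒x∈∁p x∉p) x≢y

x∈∁p-y⁻ : ∀ {n} (p : Subset n) {x y} → x ∈ ∁ p - y → x ∉ p × x ≢ y
x∈∁p-y⁻ p {y = y} x∈ =
  x∈∁p⇒x∉p (p─q⊆p (∁ p) ⁅ y ⁆ x∈) , x∉⁅y⁆⇒x≢y (x∈p─q⇒x∉q (∁ p) ⁅ y ⁆ x∈)

Empty[p∩[∁p-y]] : ∀ {n} (p : Subset n) y → Empty (p ∩ (∁ p - y))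
Empty[p∩[∁p-y]] p y (x , x∈) with x∈p∩q⁻ p (∁ p - y) x∈
... | x∈p , x∈∁p-y = proj₁ (x∈∁p-y⁻ p x∈∁p-y) x∈p

Nonempty[p∩q]⇒¬Empty : ∀ {n} {p q : Subset n} {x} → x ∈ p → x ∈ q → ¬ Empty (p ∩ q)
Nonempty[p∩q]⇒¬Empty x∈p x∈q empty = empty (_ , x∈p∩q⁺ (x∈p , x∈q))

∣p∣≡1+∣p-x∣ : ∀ {n} (p : Subset n) {x} → x ∈ p → ∣ p ∣ ≡ suc ∣ p - x ∣
∣p∣≡1+∣p-x∣ (inside  ∷ p) here       = cong (λ q → suc ∣ q ∣) (sym (p─⊥≡p p))
∣p∣≡1+∣p-x∣ (inside  ∷ p) (there x∈) = cong suc (∣p∣≡1+∣p-x∣ p x∈)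
∣p∣≡1+∣p-x∣ (outside ∷ p) (there x∈) = ∣p∣≡1+∣p-x∣ p x∈

∣p∪q∣≤∣p∣+∣q∣ : ∀ {n} (p q : Subset n) → ∣ p ∪ q ∣ ≤ ∣ p ∣ + ∣ q ∣
∣p∪q∣≤∣p∣+∣q∣ Vec.[] Vec.[] = z≤n
∣p∪q∣≤∣p∣+∣q∣ (inside ∷ p) (inside ∷ q) =
  s≤s (≤-trans (∣p∪q∣≤∣p∣+∣q∣ p q) (+-monoʳ-≤ ∣ p ∣ (n≤1+n ∣ q ∣)))
∣p∪q∣≤∣p∣+∣q∣ (inside ∷ p) (outside ∷ q) = s≤s (∣p∪q∣≤∣p∣+∣q∣ p q)
∣p∪q∣≤∣p∣+∣q∣ (outside ∷ p) (inside ∷ q) =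
  ≤-trans (s≤s (∣p∪q∣≤∣p∣+∣q∣ p q)) (≤-reflexive (sym (+-suc ∣ p ∣ ∣ q ∣)))
∣p∪q∣≤∣p∣+∣q∣ (outside ∷ p) (outside ∷ q) = ∣p∪q∣≤∣p∣+∣q∣ p q

∣p∣>0⇒Nonempty : ∀ {n} (p : Subset n) → 0 < ∣ p ∣ → Nonempty p
∣p∣>0⇒Nonempty {n} p 0<∣p∣ with nonempty? p
... | yes nonempty = nonempty
... | no  empty    =
  contradiction (trans (cong ∣_∣ (Empty-unique empty)) (∣⊥∣≡0 n)) (>⇒≢ 0<∣p∣)

x∈⋃⁺ : ∀ {n} {x : Fin n} {p ps} → p ∈ₗ ps → x ∈ p → x ∈ ⋃ ps
x∈⋃⁺ (Any.here refl)  x∈p = x∈p∪q⁺ (inj₁ x∈p)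
x∈⋃⁺ (Any.there p∈ps) x∈p = x∈p∪q⁺ (inj₂ (x∈⋃⁺ p∈ps x∈p))

x∈⋃⁻ : ∀ {n} {x : Fin n} ps → x ∈ ⋃ ps → ∃ λ p → p ∈ₗ ps × x ∈ p
x∈⋃⁻ []       x∈⊥ = contradiction x∈⊥ ∉⊥
x∈⋃⁻ (p ∷ ps) x∈ with x∈p∪q⁻ p (⋃ ps) x∈
... | inj₁ x∈p   = p , Any.here refl , x∈p
... | inj₂ x∈⋃ps with x∈⋃⁻ ps x∈⋃ps
... | q , q∈ps , x∈q = q , Any.there q∈ps , x∈q

module _ {r : ℕ} where

  ∣∁p-x∣≡r : ∀ (p : Subset (suc (2 * r))) {x} → ∣ p ∣ ≡ r → x ∉ p → ∣ ∁ p - x ∣ ≡ r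
  ∣∁p-x∣≡r p {x} ∣p∣≡r x∉p = suc-injective (begin
    suc ∣ ∁ p - x ∣    ≡⟨ sym (∣p∣≡1+∣p-x∣ (∁ p) (x∉p⇒x∈∁p x∉p)) ⟩
    ∣ ∁ p ∣            ≡⟨ ∣∁p∣≡n∸∣p∣ p ⟩
    suc (2 * r) ∸ ∣ p ∣ ≡⟨ cong₂ _∸_ (cong suc (2*n≡n+n r)) ∣p∣≡r ⟩
    suc (r + r) ∸ r    ≡⟨ cong (_∸ r) (sym (+-suc r r)) ⟩
    r + suc r ∸ r      ≡⟨ m+n∸m≡n r (suc r) ⟩
    suc r              ∎)
    where open ≡-Reasoning

  Nonempty[∁[p∪q]] : ∀ (p q : Subset (suc (2 * r))) → ∣ p ∣ ≡ r → ∣ q ∣ ≡ r →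
                     Nonempty (∁ (p ∪ q))
  Nonempty[∁[p∪q]] p q ∣p∣≡r ∣q∣≡r =
    ∣p∣>0⇒Nonempty (∁ (p ∪ q))
      (subst (0 <_) (sym (∣∁p∣≡n∸∣p∣ (p ∪ q))) (m<n⇒0<n∸m ∣p∪q∣<2r+1))
    where
    ∣p∪q∣<2r+1 : ∣ p ∪ q ∣ < suc (2 * r)
    ∣p∪q∣<2r+1 = s≤s (subst₂ (λ i j → ∣ p ∪ q ∣ ≤ i + j)
                            ∣p∣≡r (trans ∣q∣≡r (sym (+-identityʳ r)))
                            (∣p∪q∣≤∣p∣+∣q∣ p q))

image : ∀ {n m} (γ : Fin m → Fin n) {P : Pred (Fin m) 0ℓ} → Decidable P → Subset n
image {m = m} γ P? = ⋃ (map (λ i → ⁅ γ i ⁆) (filter P? (allFin m)))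

module _ {n m} (γ : Fin m → Fin n) {P : Pred (Fin m) 0ℓ} (P? : Decidable P) where

  ∈image⁺ : ∀ {i} → P i → γ i ∈ image γ P?
  ∈image⁺ {i} Pi =
    x∈⋃⁺ (∈-map∘filter⁺ (λ i → ⁅ γ i ⁆) P? (i , ∈-allFin i , refl , Pi)) (x∈⁅x⁆ (γ i))

  ∈image⁻ : ∀ {x} → x ∈ image γ P? → ∃ λ i → P i × γ i ≡ x
  ∈image⁻ x∈ with x∈⋃⁻ (map (λ i → ⁅ γ i ⁆) (filter P? (allFin m))) x∈
  ... | _ , p∈ , x∈p with ∈-map∘filter⁻ (λ i → ⁅ γ i ⁆) P? {f = λ i → ⁅ γ i ⁆} {xs = allFin m} p∈
  ... | i , _ , refl , Pi = i , Pi , sym (x∈⁅y⁆⇒x≡y (γ i) x∈p)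

module _ {n m} (γ : Fin m → Fin n) where

  ∈firstK⁺ : ∀ {k i} → toℕ i < k → γ i ∈ firstK m γ k
  ∈firstK⁺ {k} = ∈image⁺ γ (λ i → toℕ i <? k)

  ∈firstK⁻ : ∀ {k x} → x ∈ firstK m γ k → ∃ λ i → toℕ i < k × γ i ≡ x
  ∈firstK⁻ {k} = ∈image⁻ γ (λ i → toℕ i <? k)

  ∈lastK⁺ : ∀ {l i} → l ≤ toℕ i → γ i ∈ lastK m γ (m ∸ l)
  ∈lastK⁺ {l} {i} l≤i = ∈image⁺ γ (λ i → m ∸ (m ∸ l) ≤? toℕ i)
    (subst (_≤ toℕ i) (sym (m∸[m∸n]≡n (≤-trans l≤i (<⇒≤ (toℕ<n i))))) l≤i)

  ∈lastK⁻ : ∀ {l x} → l ≤ m → x ∈ lastK m γ (m ∸ l) → ∃ λ i → l ≤ toℕ i × γ i ≡ x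
  ∈lastK⁻ {l} l≤m x∈ with ∈image⁻ γ (λ i → m ∸ (m ∸ l) ≤? toℕ i) x∈
  ... | i , l≤i , γi≡x = i , subst (_≤ toℕ i) (m∸[m∸n]≡n l≤m) l≤i , γi≡x

splice : ∀ {n} m (γ δ : Fin m → Fin n) (k l : ℕ) (S : Subset n) → Subset n
splice m γ δ k l S = (firstK m γ k ∪ lastK m δ (m ∸ l)) ∪ S

module _ {n m} {γ δ : Fin m → Fin n} {k l : ℕ} {S : Subset n} where

  γ∈splice⁺ : ∀ {i} → toℕ i < k → γ i ∈ splice m γ δ k l S
  γ∈splice⁺ i<k = x∈p∪q⁺ (inj₁ (x∈p∪q⁺ (inj₁ (∈firstK⁺ γ i<k))))

  δ∈splice⁺ : ∀ {i} → l ≤ toℕ i → δ i ∈ splice m γ δ k l S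
  δ∈splice⁺ l≤i = x∈p∪q⁺ (inj₁ (x∈p∪q⁺ (inj₂ (∈lastK⁺ δ l≤i))))

  S⊆splice : ∀ {x} → x ∈ S → x ∈ splice m γ δ k l S
  S⊆splice x∈S = x∈p∪q⁺ (inj₂ x∈S)

  ∈splice⁻ : l ≤ m → ∀ {x} → x ∈ splice m γ δ k l S →
             (∃ λ i → toℕ i < k × γ i ≡ x) ⊎ (∃ λ i → l ≤ toℕ i × δ i ≡ x) ⊎ x ∈ S
  ∈splice⁻ l≤m x∈ with x∈p∪q⁻ (firstK m γ k ∪ lastK m δ (m ∸ l)) S x∈
  ... | inj₂ x∈S = inj₂ (inj₂ x∈S)
  ... | inj₁ x∈γδ with x∈p∪q⁻ (firstK m γ k) (lastK m δ (m ∸ l)) x∈γδ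
  ... | inj₁ x∈γ = inj₁ (∈firstK⁻ γ x∈γ)
  ... | inj₂ x∈δ = inj₂ (inj₁ (∈lastK⁻ δ l≤m x∈δ))

module SeparatedSplice {n m} {γ δ : Fin m → Fin n} {S : Subset n}
  (γ-injective : Injective _≡_ _≡_ γ) (δ-injective : Injective _≡_ _≡_ δ)
  (γ≢δ : ∀ i j → γ i ≢ δ j) (γ∉S : ∀ i → γ i ∉ S) (δ∉S : ∀ i → δ i ∉ S)
  {k l : ℕ} (l≤m : l ≤ m) where

  γ∈splice⁻ : ∀ {i} → γ i ∈ splice m γ δ k l S → toℕ i < k
  γ∈splice⁻ {i} γi∈ with ∈splice⁻ l≤m γi∈
  ... | inj₁ (j , j<k , γj≡γi)    = subst (λ i → toℕ i < k) (γ-injective γj≡γi) j<k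
  ... | inj₂ (inj₁ (j , _ , δj≡γi)) = contradiction (sym δj≡γi) (γ≢δ i j)
  ... | inj₂ (inj₂ γi∈S)          = contradiction γi∈S (γ∉S i)

  δ∈splice⁻ : ∀ {i} → δ i ∈ splice m γ δ k l S → l ≤ toℕ i
  δ∈splice⁻ {i} δi∈ with ∈splice⁻ l≤m δi∈
  ... | inj₁ (j , _ , γj≡δi)        = contradiction γj≡δi (γ≢δ j i)
  ... | inj₂ (inj₁ (j , l≤j , δj≡δi)) = subst (λ i → l ≤ toℕ i) (δ-injective δj≡δi) l≤j
  ... | inj₂ (inj₂ δi∈S)            = contradiction δi∈S (δ∉S i)

  ∉splice : ∀ {x} → (∀ i → γ i ≢ x) → (∀ i → δ i ≢ x) → x ∉ S → x ∉ splice m γ δ k l S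
  ∉splice γ≢x δ≢x x∉S x∈ with ∈splice⁻ l≤m x∈
  ... | inj₁ (i , _ , γi≡x)        = γ≢x i γi≡x
  ... | inj₂ (inj₁ (i , _ , δi≡x)) = δ≢x i δi≡x
  ... | inj₂ (inj₂ x∈S)           = x∉S x∈S

∈∧∉⇒≢ : ∀ {n} {p q : Subset n} {x} → x ∈ p → x ∉ q → p ≢ q
∈∧∉⇒≢ x∈p x∉q refl = x∉q x∈p

module KneserPath {r : ℕ} (a b : Subset (suc (2 * r))) (m : ℕ)
  (α β : Fin m → Fin (suc (2 * r)))
  (α-injective : Injective _≡_ _≡_ α) (β-injective : Injective _≡_ _≡_ β)
  (α-enumerates : ∀ x → x ∈ a ─ b ⇔ ∃ λ i → α i ≡ x)
  (β-enumerates : ∀ x → x ∈ b ─ a ⇔ ∃ λ i → β i ≡ x) where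

  C D : Subset (suc (2 * r))
  C = a ∩ b
  D = ∁ (a ∪ b)

  vertex : ℕ → Subset (suc (2 * r))
  vertex = pathSeq m α β C D

  evenVertex oddVertex : ℕ → Subset (suc (2 * r))
  evenVertex k = splice m β α k k C
  oddVertex  k = splice m α β k (suc k) D

  vertex-even : ∀ k → vertex (k + k) ≡ evenVertex k
  vertex-even k rewrite isEven-n+n k | sym (n≡⌊n+n/2⌋ k) = refl

  vertex-odd : ∀ k → vertex (suc (k + k)) ≡ oddVertex k
  vertex-odd k rewrite isEven-suc (k + k) | isEven-n+n k | sym (n≡⌊n+n/2⌋ k) = refl

  vertex-even-suc : ∀ k → vertex (suc (suc (k + k))) ≡ evenVertex (suc k)
  vertex-even-suc k = trans (cong vertex (cong suc (sym (+-suc k k)))) (vertex-even (suc k))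

  α∈a─b : ∀ i → α i ∈ a ─ b
  α∈a─b i = from (α-enumerates (α i)) (i , refl)

  β∈b─a : ∀ i → β i ∈ b ─ a
  β∈b─a i = from (β-enumerates (β i)) (i , refl)

  α∈a : ∀ i → α i ∈ a
  α∈a i = p─q⊆p a b (α∈a─b i)

  β∈b : ∀ i → β i ∈ b
  β∈b i = p─q⊆p b a (β∈b─a i)

  α∉b : ∀ i → α i ∉ b
  α∉b i = x∈p─q⇒x∉q a b (α∈a─b i)

  β∉a : ∀ i → β i ∉ a
  β∉a i = x∈p─q⇒x∉q b a (β∈b─a i)

  α≢β : ∀ i j → α i ≢ β j
  α≢β i j αi≡βj = α∉b i (subst (_∈ b) (sym αi≡βj) (β∈b j))

  C⊆a : ∀ {x} → x ∈ C → x ∈ a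
  C⊆a x∈C = proj₁ (x∈p∩q⁻ a b x∈C)

  C⊆b : ∀ {x} → x ∈ C → x ∈ b
  C⊆b x∈C = proj₂ (x∈p∩q⁻ a b x∈C)

  ∈D⇒∉a : ∀ {x} → x ∈ D → x ∉ a
  ∈D⇒∉a x∈D x∈a = x∈∁p⇒x∉p x∈D (x∈p∪q⁺ (inj₁ x∈a))

  ∈D⇒∉b : ∀ {x} → x ∈ D → x ∉ b
  ∈D⇒∉b x∈D x∈b = x∈∁p⇒x∉p x∈D (x∈p∪q⁺ (inj₂ x∈b))

  data Kind (x : Fin (suc (2 * r))) : Set where
    inC : x ∈ C → Kind x
    inD : x ∈ D → Kind x
    isα : ∀ i → α i ≡ x → Kind x
    isβ : ∀ i → β i ≡ x → Kind x

  kind : ∀ x → Kind x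
  kind x with x ∈? a | x ∈? b
  ... | yes x∈a | yes x∈b = inC (x∈p∩q⁺ (x∈a , x∈b))
  ... | yes x∈a | no  x∉b = let i , αi≡x = to (α-enumerates x) (x∈p∧x∉q⇒x∈p─q x∈a x∉b) in isα i αi≡x
  ... | no  x∉a | yes x∈b = let i , βi≡x = to (β-enumerates x) (x∈p∧x∉q⇒x∈p─q x∈b x∉a) in isβ i βi≡x
  ... | no  x∉a | no  x∉b = inD (x∉p⇒x∈∁p λ x∈a∪b → [ x∉a , x∉b ]′ (x∈p∪q⁻ a b x∈a∪b))

  α∉C : ∀ i → α i ∉ C
  α∉C i = α∉b i ∘ C⊆b

  β∉C : ∀ i → β i ∉ C
  β∉C i = β∉a i ∘ C⊆a

  α∉D : ∀ i → α i ∉ D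
  α∉D i x∈D = ∈D⇒∉a x∈D (α∈a i)

  β∉D : ∀ i → β i ∉ D
  β∉D i x∈D = ∈D⇒∉b x∈D (β∈b i)

  private
    module Even {k} (k≤m : k ≤ m) =
      SeparatedSplice β-injective α-injective (λ i j → α≢β j i ∘ sym) β∉C α∉C {k} {k} k≤m
    module Odd {k} (k<m : k < m) =
      SeparatedSplice α-injective β-injective α≢β α∉D β∉D {k} {suc k} k<m

  module _ {k : ℕ} where

    α∈evenVertex⁺ : ∀ {i} → k ≤ toℕ i → α i ∈ evenVertex k
    α∈evenVertex⁺ = δ∈splice⁺ {k = k} {l = k}

    β∈evenVertex⁺ : ∀ {i} → toℕ i < k → β i ∈ evenVertex k
    β∈evenVertex⁺ = γ∈splice⁺ {k = k} {l = k}

    C⊆evenVertex : ∀ {x} → x ∈ C → x ∈ evenVertex k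
    C⊆evenVertex = S⊆splice {γ = β} {α} {k} {k}

    α∈evenVertex⁻ : k ≤ m → ∀ {i} → α i ∈ evenVertex k → k ≤ toℕ i
    α∈evenVertex⁻ k≤m = Even.δ∈splice⁻ k≤m

    β∈evenVertex⁻ : k ≤ m → ∀ {i} → β i ∈ evenVertex k → toℕ i < k
    β∈evenVertex⁻ k≤m = Even.γ∈splice⁻ k≤m

    ∈D⇒∉evenVertex : k ≤ m → ∀ {x} → x ∈ D → x ∉ evenVertex k
    ∈D⇒∉evenVertex k≤m x∈D =
      Even.∉splice k≤m (λ { i refl → β∉D i x∈D }) (λ { i refl → α∉D i x∈D })
                       (λ x∈C → ∈D⇒∉a x∈D (C⊆a x∈C))

    α∈oddVertex⁺ : ∀ {i} → toℕ i < k → α i ∈ oddVertex k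
    α∈oddVertex⁺ = γ∈splice⁺ {k = k} {l = suc k}

    β∈oddVertex⁺ : ∀ {i} → k < toℕ i → β i ∈ oddVertex k
    β∈oddVertex⁺ = δ∈splice⁺ {k = k} {l = suc k}

    D⊆oddVertex : ∀ {x} → x ∈ D → x ∈ oddVertex k
    D⊆oddVertex = S⊆splice {γ = α} {β} {k} {suc k}

    α∈oddVertex⁻ : k < m → ∀ {i} → α i ∈ oddVertex k → toℕ i < k
    α∈oddVertex⁻ k<m = Odd.γ∈splice⁻ k<m

    β∈oddVertex⁻ : k < m → ∀ {i} → β i ∈ oddVertex k → k < toℕ i
    β∈oddVertex⁻ k<m = Odd.δ∈splice⁻ k<m

    ∈C⇒∉oddVertex : k < m → ∀ {x} → x ∈ C → x ∉ oddVertex k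
    ∈C⇒∉oddVertex k<m x∈C =
      Odd.∉splice k<m (λ { i refl → α∉C i x∈C }) (λ { i refl → β∉C i x∈C })
                      (λ x∈D → ∈D⇒∉a x∈D (C⊆a x∈C))

  evenVertex0≡a : evenVertex 0 ≡ a
  evenVertex0≡a = ⊆-antisym ⊆a a⊆
    where
    ⊆a : ∀ {x} → x ∈ evenVertex 0 → x ∈ a
    ⊆a {x} x∈ with kind x
    ... | inC x∈C    = C⊆a x∈C
    ... | inD x∈D    = contradiction x∈ (∈D⇒∉evenVertex z≤n x∈D)
    ... | isα i refl = α∈a i
    ... | isβ i refl = contradiction (β∈evenVertex⁻ z≤n x∈) λ ()
    a⊆ : ∀ {x} → x ∈ a → x ∈ evenVertex 0
    a⊆ {x} x∈a with kind x
    ... | inC x∈C    = C⊆evenVertex x∈C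
    ... | inD x∈D    = contradiction x∈a (∈D⇒∉a x∈D)
    ... | isα i refl = α∈evenVertex⁺ z≤n
    ... | isβ i refl = contradiction x∈a (β∉a i)

  evenVertex-m≡b : evenVertex m ≡ b
  evenVertex-m≡b = ⊆-antisym ⊆b b⊆
    where
    ⊆b : ∀ {x} → x ∈ evenVertex m → x ∈ b
    ⊆b {x} x∈ with kind x
    ... | inC x∈C    = C⊆b x∈C
    ... | inD x∈D    = contradiction x∈ (∈D⇒∉evenVertex ≤-refl x∈D)
    ... | isα i refl = contradiction (α∈evenVertex⁻ ≤-refl x∈) (<⇒≱ (toℕ<n i))
    ... | isβ i refl = β∈b i
    b⊆ : ∀ {x} → x ∈ b → x ∈ evenVertex m
    b⊆ {x} x∈b with kind x
    ... | inC x∈C    = C⊆evenVertex x∈C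
    ... | inD x∈D    = contradiction x∈b (∈D⇒∉b x∈D)
    ... | isα i refl = contradiction x∈b (α∉b i)
    ... | isβ i refl = β∈evenVertex⁺ (toℕ<n i)

  module _ {k : ℕ} (k<m : k < m) where

    private
      αₖ βₖ : Fin (suc (2 * r))
      αₖ = α (fromℕ< k<m)
      βₖ = β (fromℕ< k<m)

      γᵢ≡γₖ⇒i≡k : ∀ {γ : Fin m → Fin (suc (2 * r))} → Injective _≡_ _≡_ γ →
                    ∀ {i} → γ i ≡ γ (fromℕ< k<m) → toℕ i ≡ k
      γᵢ≡γₖ⇒i≡k γ-injective γi≡γₖ = trans (cong toℕ (γ-injective γi≡γₖ)) (toℕ-fromℕ< k<m)

      i≡k⇒γᵢ≡γₖ : ∀ (γ : Fin m → Fin (suc (2 * r))) {i} → toℕ i ≡ k → γ i ≡ γ (fromℕ< k<m)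
      i≡k⇒γᵢ≡γₖ γ i≡k = cong γ (toℕ-injective (trans i≡k (sym (toℕ-fromℕ< k<m))))

    oddVertex≡∁evenVertex-βₖ : oddVertex k ≡ ∁ (evenVertex k) - βₖ
    oddVertex≡∁evenVertex-βₖ = ⊆-antisym ⊆∁ ∁⊆
      where
      k≤m = <⇒≤ k<m
      ⊆∁ : ∀ {x} → x ∈ oddVertex k → x ∈ ∁ (evenVertex k) - βₖ
      ⊆∁ {x} x∈ with kind x
      ... | inC x∈C    = contradiction x∈ (∈C⇒∉oddVertex k<m x∈C)
      ... | inD x∈D    = x∈∁p-y⁺ (∈D⇒∉evenVertex k≤m x∈D) λ { refl → β∉D _ x∈D }
      ... | isα i refl = x∈∁p-y⁺ (<⇒≱ (α∈oddVertex⁻ k<m x∈) ∘ α∈evenVertex⁻ k≤m) (α≢β i _)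
      ... | isβ i refl = x∈∁p-y⁺ (<-asym (β∈oddVertex⁻ k<m x∈) ∘ β∈evenVertex⁻ k≤m)
                                 (>⇒≢ (β∈oddVertex⁻ k<m x∈) ∘ γᵢ≡γₖ⇒i≡k β-injective)
      ∁⊆ : ∀ {x} → x ∈ ∁ (evenVertex k) - βₖ → x ∈ oddVertex k
      ∁⊆ {x} x∈ with x∈∁p-y⁻ (evenVertex k) x∈ | kind x
      ... | x∉ , _     | inC x∈C    = contradiction (C⊆evenVertex x∈C) x∉
      ... | _          | inD x∈D    = D⊆oddVertex x∈D
      ... | x∉ , _     | isα i refl = α∈oddVertex⁺ (≰⇒> (x∉ ∘ α∈evenVertex⁺))
      ... | x∉ , x≢βₖ  | isβ i refl =
        β∈oddVertex⁺ (≤∧≢⇒< (≮⇒≥ (x∉ ∘ β∈evenVertex⁺)) (x≢βₖ ∘ i≡k⇒γᵢ≡γₖ β ∘ sym))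

    evenVertex-suc≡∁oddVertex-αₖ : evenVertex (suc k) ≡ ∁ (oddVertex k) - αₖ
    evenVertex-suc≡∁oddVertex-αₖ = ⊆-antisym ⊆∁ ∁⊆
      where
      ⊆∁ : ∀ {x} → x ∈ evenVertex (suc k) → x ∈ ∁ (oddVertex k) - αₖ
      ⊆∁ {x} x∈ with kind x
      ... | inC x∈C    = x∈∁p-y⁺ (∈C⇒∉oddVertex k<m x∈C) λ { refl → α∉C _ x∈C }
      ... | inD x∈D    = contradiction x∈ (∈D⇒∉evenVertex k<m x∈D)
      ... | isα i refl = x∈∁p-y⁺ (λ x∈odd → <⇒≱ (α∈oddVertex⁻ k<m x∈odd)
                                                 (<⇒≤ (α∈evenVertex⁻ k<m x∈)))
                                 (>⇒≢ (α∈evenVertex⁻ k<m x∈) ∘ γᵢ≡γₖ⇒i≡k α-injective)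
      ... | isβ i refl = x∈∁p-y⁺ (λ x∈odd → <⇒≱ (β∈oddVertex⁻ k<m x∈odd)
                                                 (s≤s⁻¹ (β∈evenVertex⁻ k<m x∈)))
                                 (α≢β _ i ∘ sym)
      ∁⊆ : ∀ {x} → x ∈ ∁ (oddVertex k) - αₖ → x ∈ evenVertex (suc k)
      ∁⊆ {x} x∈ with x∈∁p-y⁻ (oddVertex k) x∈ | kind x
      ... | _          | inC x∈C    = C⊆evenVertex x∈C
      ... | x∉ , _     | inD x∈D    = contradiction (D⊆oddVertex x∈D) x∉
      ... | x∉ , x≢αₖ  | isα i refl =
        α∈evenVertex⁺ (≤∧≢⇒< (≮⇒≥ (x∉ ∘ α∈oddVertex⁺)) (x≢αₖ ∘ i≡k⇒γᵢ≡γₖ α ∘ sym))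
      ... | x∉ , _     | isβ i refl = β∈evenVertex⁺ (s≤s (≮⇒≥ (x∉ ∘ β∈oddVertex⁺)))

  module _ (∣a∣≡r : ∣ a ∣ ≡ r) where

    ∣evenVertex∣≡r : ∀ k → k ≤ m → ∣ evenVertex k ∣ ≡ r
    ∣oddVertex∣≡r  : ∀ k → k < m → ∣ oddVertex k ∣ ≡ r

    ∣evenVertex∣≡r zero    _   = trans (cong ∣_∣ evenVertex0≡a) ∣a∣≡r
    ∣evenVertex∣≡r (suc k) k<m = trans (cong ∣_∣ (evenVertex-suc≡∁oddVertex-αₖ k<m))
      (∣∁p-x∣≡r (oddVertex k) (∣oddVertex∣≡r k k<m)
        (<-irrefl (toℕ-fromℕ< k<m) ∘ α∈oddVertex⁻ k<m))

    ∣oddVertex∣≡r k k<m = trans (cong ∣_∣ (oddVertex≡∁evenVertex-βₖ k<m))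
      (∣∁p-x∣≡r (evenVertex k) (∣evenVertex∣≡r k (<⇒≤ k<m))
        (<-irrefl (toℕ-fromℕ< k<m) ∘ β∈evenVertex⁻ (<⇒≤ k<m)))

    ∣vertex∣≡r : ∀ j → j ≤ m + m → ∣ vertex j ∣ ≡ r
    ∣vertex∣≡r j j≤m+m with parity j
    ... | even k = trans (cong ∣_∣ (vertex-even k)) (∣evenVertex∣≡r k (k+k≤l+l⇒k≤l j≤m+m))
    ... | odd  k = trans (cong ∣_∣ (vertex-odd k)) (∣oddVertex∣≡r k (k+k<l+l⇒k<l j≤m+m))

  evenVertex-≢ : ∀ {k l} → k < l → l ≤ m → evenVertex k ≢ evenVertex l
  evenVertex-≢ {k} {l} k<l l≤m =
    ∈∧∉⇒≢ (α∈evenVertex⁺ (≤-reflexive (sym ≡k)))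
           (<⇒≱ k<l ∘ subst (l ≤_) ≡k ∘ α∈evenVertex⁻ l≤m)
    where ≡k = toℕ-fromℕ< (<-≤-trans k<l l≤m)

  oddVertex-≢ : ∀ {k l} → k < l → l < m → oddVertex k ≢ oddVertex l
  oddVertex-≢ {k} {l} k<l l<m =
    ∈∧∉⇒≢ (β∈oddVertex⁺ (subst (k <_) (sym ≡l) k<l))
           (<-irrefl (sym ≡l) ∘ β∈oddVertex⁻ l<m)
    where ≡l = toℕ-fromℕ< l<m

  module _ {c} (c∈C : c ∈ C) where

    evenVertex≢oddVertex : ∀ {k l} → l < m → evenVertex k ≢ oddVertex l
    evenVertex≢oddVertex l<m = ∈∧∉⇒≢ (C⊆evenVertex c∈C) (∈C⇒∉oddVertex l<m c∈C)

    vertex-≢ : ∀ {i j} → i < j → j ≤ m + m → vertex i ≢ vertex j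
    vertex-≢ {i} {j} i<j j≤m+m with parity i | parity j
    ... | even k | even l rewrite vertex-even k | vertex-even l =
      evenVertex-≢ (k+k<l+l⇒k<l i<j) (k+k≤l+l⇒k≤l j≤m+m)
    ... | even k | odd l rewrite vertex-even k | vertex-odd l =
      evenVertex≢oddVertex (k+k<l+l⇒k<l j≤m+m)
    ... | odd k | even l rewrite vertex-odd k | vertex-even l =
      ≢-sym (evenVertex≢oddVertex (k+k<l+l⇒k<l (<-trans (n<1+n (k + k)) (<-≤-trans i<j j≤m+m))))
    ... | odd k | odd l rewrite vertex-odd k | vertex-odd l =
      oddVertex-≢ (k+k<l+l⇒k<l (s<s⁻¹ i<j)) (k+k<l+l⇒k<l j≤m+m)

    vertex-injective : ∀ i j → i ≤ m + m → j ≤ m + m → vertex i ≡ vertex j → i ≡ j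
    vertex-injective i j i≤m+m j≤m+m vᵢ≡vⱼ with <-cmp i j
    ... | tri< i<j _ _ = contradiction vᵢ≡vⱼ (vertex-≢ i<j j≤m+m)
    ... | tri≈ _ i≡j _ = i≡j
    ... | tri> _ _ j<i = contradiction (sym vᵢ≡vⱼ) (vertex-≢ j<i i≤m+m)

  vertex-adjacent : ∀ j → j < m + m → KneserAdj (vertex j) (vertex (suc j))
  vertex-adjacent j j<m+m with parity j
  ... | even k = subst₂ KneserAdj (sym (vertex-even k))
    (sym (trans (vertex-odd k) (oddVertex≡∁evenVertex-βₖ (k+k<l+l⇒k<l j<m+m))))
    (Empty[p∩[∁p-y]] (evenVertex k) _)
  ... | odd k = subst₂ KneserAdj (sym (vertex-odd k))
    (sym (trans (vertex-even-suc k)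
                (evenVertex-suc≡∁oddVertex-αₖ (k+k<l+l⇒k<l (<-trans (n<1+n _) j<m+m)))))
    (Empty[p∩[∁p-y]] (oddVertex k) _)

  vertex-nonadjacent : Nonempty C → Nonempty D →
    ∀ i j → j ≤ m + m → suc (suc i) ≤ j → ¬ KneserAdj (vertex i) (vertex j)
  vertex-nonadjacent (c , c∈C) (d , d∈D) i j j≤m+m i+2≤j with parity i | parity j
  ... | even k | even l rewrite vertex-even k | vertex-even l =
    Nonempty[p∩q]⇒¬Empty (C⊆evenVertex c∈C) (C⊆evenVertex c∈C)
  ... | odd k | odd l rewrite vertex-odd k | vertex-odd l =
    Nonempty[p∩q]⇒¬Empty (D⊆oddVertex d∈D) (D⊆oddVertex d∈D)
  ... | even k | odd l rewrite vertex-even k | vertex-odd l =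
    Nonempty[p∩q]⇒¬Empty (α∈evenVertex⁺ (≤-reflexive (sym ≡k)))
                         (α∈oddVertex⁺ (subst (_< l) (sym ≡k) k<l))
    where
    k<l = k+k<l+l⇒k<l (s≤s⁻¹ i+2≤j)
    ≡k = toℕ-fromℕ< (<-trans k<l (k+k<l+l⇒k<l {l} {m} j≤m+m))
  ... | odd k | even l rewrite vertex-odd k | vertex-even l =
    Nonempty[p∩q]⇒¬Empty (β∈oddVertex⁺ (subst (k <_) (sym ≡k+1) (n<1+n k)))
                         (β∈evenVertex⁺ (subst (_< l) (sym ≡k+1) k+1<l))
    where
    k+1<l = k+k<l+l⇒k<l (subst (λ n → suc (suc n) ≤ l + l) (sym (+-suc k k)) i+2≤j)
    ≡k+1 = toℕ-fromℕ< (<-≤-trans k+1<l (k+k≤l+l⇒k≤l {l} {m} j≤m+m))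

  vertex[0]≡a : vertex 0 ≡ a
  vertex[0]≡a = evenVertex0≡a

  vertex[2m]≡b : vertex (2 * m) ≡ b
  vertex[2m]≡b = trans (cong vertex (2*n≡n+n m)) (trans (vertex-even m) evenVertex-m≡b)

  isInducedKneserPath : ∣ a ∣ ≡ r → Nonempty C → Nonempty D →
                        IsInducedKneserPath r vertex (2 * m)
  isInducedKneserPath ∣a∣≡r C≢∅ D≢∅ rewrite 2*n≡n+n m =
    ∣vertex∣≡r ∣a∣≡r , vertex-injective (proj₂ C≢∅) ,
    vertex-adjacent , vertex-nonadjacent C≢∅ D≢∅

lemma2p4 : (r t : ℕ) → 1 ≤ r → (a b : Subset (suc (2 * r)))
    → IsKneserVertex r a → IsKneserVertex r b
    → ∣ a ∩ b ∣ ≡ t → 1 ≤ t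
    → (α β : Fin (r ∸ t) → Fin (suc (2 * r)))
    → Injective _≡_ _≡_ α → Injective _≡_ _≡_ β
    → (∀ x → (x ∈ (a ─ b)) ⇔ (∃ λ i → α i ≡ x))
    → (∀ x → (x ∈ (b ─ a)) ⇔ (∃ λ i → β i ≡ x))
    → pathSeq (r ∸ t) α β (a ∩ b) (∁ (a ∪ b)) 0 ≡ a
      × pathSeq (r ∸ t) α β (a ∩ b) (∁ (a ∪ b)) (2 * (r ∸ t)) ≡ b
      × IsInducedKneserPath r (pathSeq (r ∸ t) α β (a ∩ b) (∁ (a ∪ b))) (2 * (r ∸ t))
lemma2p4 r t _ a b ∣a∣≡r ∣b∣≡r ∣a∩b∣≡t 1≤t α β α-injective β-injective
         α-enumerates β-enumerates =
  vertex[0]≡a , vertex[2m]≡b ,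
  isInducedKneserPath ∣a∣≡r
    (∣p∣>0⇒Nonempty (a ∩ b) (subst (0 <_) (sym ∣a∩b∣≡t) 1≤t))
    (Nonempty[∁[p∪q]] a b ∣a∣≡r ∣b∣≡r)
  where open KneserPath {r} a b (r ∸ t) α β α-injective β-injective α-enumerates β-enumerates
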